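{- Let $(X,d_X)$, $(Y,d_Y)$, $(Z,d_Z)$ be finite metric spaces, and let $f:X\to Y$ and $g:Y\to Z$ be non-contractive onto embeddings with scaling distortion $\alpha$ and $\beta$ respectively. Then $g\circ f$ has scaling distortion $\epsilon\mapsto\alpha(\epsilon/2)\cdot\beta(\epsilon/2)$.
   Context: An embedding $h:A\to B$ is non-contractive if $d_B(h(a),h(a'))\ge d_A(a,a')$ for all $a,a'$; the distortion of a pair is $d_B(h(a),h(a'))/d_A(a,a')$. $h$ has scaling distortion $\gamma:(0,1)\to\mathbb{R}_+$ if for every $\epsilon\in(0,1)$ at least $(1-\epsilon)\binom{|A|}{2}$ pairs have distortion at most $\gamma(\epsilon)$. -}

module Defs where

open import Level using (Level; _⊔_) renaming (suc to lsuc)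
open import Data.Nat using (ℕ; zero; suc)
open import Data.Nat.Combinatorics using (_C_)
open import Data.Fin using (Fin; _<_)
open import Data.Fin.Properties using (_<?_)
open import Data.List using (List; []; _∷_; length; filter; allFin; concatMap; map)
open import Data.Product using (_×_; _,_; proj₁; proj₂; ∃)
open import Relation.Binary.PropositionalEquality using (_≡_)
open import Relation.Nullary using (¬_; Dec)
open import Relation.Unary using (Decidable)
open import Relation.Binary using (Rel; IsDecTotalOrder)
open import Algebra.Bundles using (CommutativeRing)
open import Function using (Surjective)

-- An ordered field (abstract; ℝ is an instance).  Inverse is total; only
-- its value on nonzero elements is constrained.
record OrderedField (c ℓ₁ ℓ₂ : Level) : Set (lsuc (c ⊔ ℓ₁ ⊔ ℓ₂)) where
  field
    commutativeRing : CommutativeRing c ℓ₁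
  open CommutativeRing commutativeRing public
  infix 4 _≤_
  infix 8 _⁻¹
  field
    _≤_          : Rel Carrier ℓ₂
    isDecTotalOrder : IsDecTotalOrder _≈_ _≤_
    0≉1          : ¬ (0# ≈ 1#)
    _⁻¹          : Carrier → Carrier
    ⁻¹-inverse   : ∀ x → ¬ (x ≈ 0#) → x * x ⁻¹ ≈ 1#
    +-mono-≤     : ∀ {x y} z → x ≤ y → x + z ≤ y + z
    *-nonneg     : ∀ {x y} → 0# ≤ x → 0# ≤ y → 0# ≤ x * y
  open IsDecTotalOrder isDecTotalOrder public using (_≤?_)

  _<ᶠ_ : Carrier → Carrier → Set (ℓ₁ ⊔ ℓ₂)
  x <ᶠ y = (x ≤ y) × ¬ (x ≈ y)

  fromℕ : ℕ → Carrier
  fromℕ zero    = 0#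
  fromℕ (suc n) = 1# + fromℕ n

  2# : Carrier
  2# = 1# + 1#

module _ {c ℓ₁ ℓ₂} (F : OrderedField c ℓ₁ ℓ₂) where
  open OrderedField F

  record FiniteMetric (n : ℕ) : Set (c ⊔ ℓ₁ ⊔ ℓ₂) where
    field
      d         : Fin n → Fin n → Carrier
      nonneg    : ∀ x y → 0# ≤ d x y
      zero⇔eq₁  : ∀ x y → d x y ≈ 0# → x ≡ y
      zero⇔eq₂  : ∀ x → d x x ≈ 0#
      sym       : ∀ x y → d x y ≈ d y x
      triangle  : ∀ x y z → d x z ≤ d x y + d y z

  open FiniteMetric

  -- Unordered pairs {i,j}, i ≠ j, listed once each as (i , j) with i < j.
  pairs : (n : ℕ) → List (Fin n × Fin n)
  pairs n = filter (λ p → proj₁ p <? proj₂ p)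
              (concatMap (λ i → map (λ j → (i , j)) (allFin n)) (allFin n))

  module _ {n m : ℕ} (A : FiniteMetric n) (B : FiniteMetric m) (h : Fin n → Fin m) where

    NonContractive : Set ℓ₂
    NonContractive = ∀ a a' → d A a a' ≤ d B (h a) (h a')

    distortion : Fin n → Fin n → Carrier
    distortion a a' = d B (h a) (h a') * (d A a a') ⁻¹

    countGood : Carrier → ℕ
    countGood t = length (filter (λ p → distortion (proj₁ p) (proj₂ p) ≤? t) (pairs n))

    -- h has scaling distortion γ : (0,1) → ℝ₊ (γ given as a total function,
    -- only its values on (0,1) matter; they are required to be positive).
    HasScalingDistortion : (Carrier → Carrier) → Set (c ⊔ ℓ₁ ⊔ ℓ₂)
    HasScalingDistortion γ =
      ∀ ε → 0# <ᶠ ε → ε <ᶠ 1# →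
        (0# <ᶠ γ ε) ×
        ((1# - ε) * fromℕ (n C 2) ≤ fromℕ (countGood (γ ε)))

-- Fix ε ∈ (0,1) and h = ε/2.  A pair {a,a'} of X that is good for f at α(h)
-- and whose image {f a, f a'} is good for g at β(h) is good for g ∘ f at
-- α(h)·β(h), since distortions multiply along a composition.  Because f is
-- onto, every pair of Y is the image of a pair of X, so at least as many pairs
-- of X have a good image as Y has good pairs; and |X| = |Y| as f is a bijection.
-- Inclusion–exclusion over the N = |X| C 2 pairs of X then leaves at most
-- hN + hN = εN pairs that are bad for g ∘ f.
module Submission where

open import Defs
open import Level using (Level)
open import Data.Nat using (ℕ)
open import Data.Fin using (Fin)
open import Data.Product using (_×_)
open import Function using (_∘_; Surjective)
open import Relation.Binary.PropositionalEquality using (_≡_)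

import Data.Nat as Nat
open Nat using (zero; suc; _∸_; z≤n; s≤s)
import Data.Nat.Properties as ℕₚ
open import Data.Nat.Combinatorics using (_C_; nC1≡n; nCk+nC[k+1]≡[n+1]C[k+1])
open import Data.Fin as Fin using (toℕ; _≟_)
open import Data.Fin.Properties using (_<?_; <⇒≢; <-asym; ≤∧≢⇒<; cantor-schröder-bernstein)
open import Data.List
  using (List; []; _∷_; _++_; length; filter; map; allFin; tabulate; concatMap; cartesianProduct)
open import Data.List.Properties
  using (length-++; filter-++; filter-all; filter-≐; length-tabulate; map-tabulate)
open import Data.Nat.ListAction using (sum)
open import Data.List.Membership.Propositional using (_∈_)
open import Data.List.Membership.Propositional.Properties
  using (∈-filter⁺; ∈-filter⁻; ∈-allFin; ∈-cartesianProduct⁺; ∈-∃++; ∈-++⁻; ∈-++⁺ˡ; ∈-++⁺ʳ)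
import Data.List.Relation.Unary.All as All
open import Data.List.Relation.Unary.All.Properties using (tabulate⁺)
open import Data.List.Relation.Unary.Any using (here; there)
open import Data.List.Relation.Unary.AllPairs using (_∷_)
open import Data.List.Relation.Unary.Unique.Propositional using (Unique)
import Data.List.Relation.Unary.Unique.Propositional.Properties as Unique
open import Data.List.Relation.Binary.Sublist.Propositional using (⊆-refl)
open import Data.List.Relation.Binary.Sublist.Propositional.Properties using (length-mono-≤)
import Data.List.Relation.Binary.Sublist.Propositional.Properties as Sublist
open import Data.Product using (_,_; proj₁; proj₂)
open import Data.Product.Properties using () renaming (,-injective to components)
import Data.Product as Product
open import Data.Sum using (_⊎_; inj₁; inj₂)
open import Data.Empty using (⊥-elim)
open import Relation.Nullary using (¬_; yes; no)
open import Relation.Unary using (Pred; Decidable)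
open import Relation.Unary.Properties using (_∩?_)
open import Relation.Binary using (IsDecTotalOrder)
open import Relation.Binary.Bundles using (Poset)
open import Relation.Binary.PropositionalEquality as ≡ using (refl; _≢_; cong; cong₂; subst; subst₂)
import Algebra.Properties.Ring as RingProperties
import Algebra.Properties.CommutativeSemigroup as CommutativeSemigroupProperties

private
  variable
    a p q : Level
    A B : Set a

module Section {f : A → B} (f-surj : Surjective _≡_ _≡_ f) where

  section : B → A
  section y = proj₁ (f-surj y)

  f∘section : ∀ y → f (section y) ≡ y
  f∘section y = proj₂ (f-surj y) refl

  section-injective : ∀ {y y'} → section y ≡ section y' → y ≡ y'
  section-injective {y} {y'} e = ≡.trans (≡.sym (f∘section y)) (≡.trans (cong f e) (f∘section y'))

module OrderedFieldProperties {c ℓ₁ ℓ₂} (F : OrderedField c ℓ₁ ℓ₂) where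
  open OrderedField F
  open RingProperties ring
    using (+-identityʳ-unique; //-rightDividesˡ; //-rightDividesʳ; -‿+-comm; [y-z]x≈yx-zx; -1*x≈-x; -‿involutive)
  open CommutativeSemigroupProperties +-commutativeSemigroup using (xy∙z≈xz∙y; interchange)
  module ≤ = IsDecTotalOrder isDecTotalOrder

  ≤-poset : Poset c ℓ₁ ℓ₂
  ≤-poset = record { isPartialOrder = ≤.isPartialOrder }

  open import Relation.Binary.Reasoning.PartialOrder ≤-poset

  +-monoʳ-≤ : ∀ {x y} z → x ≤ y → z + x ≤ z + y
  +-monoʳ-≤ {x} {y} z x≤y = begin
    z + x  ≈⟨ +-comm z x ⟩
    x + z  ≤⟨ +-mono-≤ z x≤y ⟩
    y + z  ≈⟨ +-comm y z ⟩
    z + y  ∎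

  +-mono₂-≤ : ∀ {x y u v} → x ≤ y → u ≤ v → x + u ≤ y + v
  +-mono₂-≤ {y = y} {u} x≤y u≤v = ≤.trans (+-mono-≤ u x≤y) (+-monoʳ-≤ y u≤v)

  +-cancelʳ-≤ : ∀ {x y} z → x + z ≤ y + z → x ≤ y
  +-cancelʳ-≤ {x} {y} z x+z≤y+z = begin
    x            ≈⟨ //-rightDividesʳ z x ⟨
    (x + z) - z  ≤⟨ +-mono-≤ (- z) x+z≤y+z ⟩
    (y + z) - z  ≈⟨ //-rightDividesʳ z y ⟩
    y            ∎

  x≤y⇒0≤y-x : ∀ {x y} → x ≤ y → 0# ≤ y - x
  x≤y⇒0≤y-x {x} {y} x≤y = begin
    0#     ≈⟨ -‿inverseʳ x ⟨
    x - x  ≤⟨ +-mono-≤ (- x) x≤y ⟩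
    y - x  ∎

  *-monoˡ-≤ : ∀ {x y z} → 0# ≤ z → x ≤ y → x * z ≤ y * z
  *-monoˡ-≤ {x} {y} {z} 0≤z x≤y = begin
    x * z                    ≈⟨ +-identityˡ (x * z) ⟨
    0# + x * z               ≤⟨ +-mono-≤ (x * z) (*-nonneg (x≤y⇒0≤y-x x≤y) 0≤z) ⟩
    (y - x) * z + x * z      ≈⟨ +-congʳ ([y-z]x≈yx-zx z y x) ⟩
    (y * z - x * z) + x * z  ≈⟨ //-rightDividesˡ (x * z) (y * z) ⟩
    y * z                    ∎

  *-monoʳ-≤ : ∀ {x y z} → 0# ≤ z → x ≤ y → z * x ≤ z * y
  *-monoʳ-≤ {x} {y} {z} 0≤z x≤y = begin
    z * x  ≈⟨ *-comm z x ⟩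
    x * z  ≤⟨ *-monoˡ-≤ 0≤z x≤y ⟩
    y * z  ≈⟨ *-comm y z ⟩
    z * y  ∎

  *-mono-≤ : ∀ {x x' y y'} → 0# ≤ y → 0# ≤ x' → x ≤ x' → y ≤ y' → x * y ≤ x' * y'
  *-mono-≤ 0≤y 0≤x' x≤x' y≤y' = ≤.trans (*-monoˡ-≤ 0≤y x≤x') (*-monoʳ-≤ 0≤x' y≤y')

  -- 1 is non-negative, because otherwise 1 = (-1)·(-1) would be.
  0≤1 : 0# ≤ 1#
  0≤1 with ≤.total 0# 1#
  ... | inj₁ 0≤1 = 0≤1
  ... | inj₂ 1≤0 = begin
    0#                     ≤⟨ *-nonneg (x≤y⇒0≤y-x 1≤0) (x≤y⇒0≤y-x 1≤0) ⟩
    (0# - 1#) * (0# - 1#)  ≈⟨ *-cong (+-identityˡ (- 1#)) (+-identityˡ (- 1#)) ⟩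
    - 1# * - 1#            ≈⟨ -1*x≈-x (- 1#) ⟩
    - - 1#                 ≈⟨ -‿involutive 1# ⟩
    1#                     ∎

  <ᶠ-trans : ∀ {x y z} → x <ᶠ y → y <ᶠ z → x <ᶠ z
  <ᶠ-trans (x≤y , x≉y) (y≤z , y≉z) =
    ≤.trans x≤y y≤z , λ x≈z → x≉y (≤.antisym x≤y (≤.trans y≤z (≤.reflexive (sym x≈z))))

  <ᶠ-respʳ-≈ : ∀ {x y z} → x <ᶠ y → y ≈ z → x <ᶠ z
  <ᶠ-respʳ-≈ (x≤y , x≉y) y≈z = ≤.trans x≤y (≤.reflexive y≈z) , λ x≈z → x≉y (trans x≈z (sym y≈z))

  x<x+y : ∀ {x y} → 0# <ᶠ y → x <ᶠ (x + y)
  x<x+y {x} {y} (0≤y , 0≉y) =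
    (begin x ≈⟨ +-identityʳ x ⟨ x + 0# ≤⟨ +-monoʳ-≤ x 0≤y ⟩ x + y ∎) ,
    λ x≈x+y → 0≉y (sym (+-identityʳ-unique x y (sym x≈x+y)))

  0<1 : 0# <ᶠ 1#
  0<1 = 0≤1 , 0≉1

  0<2 : 0# <ᶠ 2#
  0<2 = <ᶠ-trans 0<1 (x<x+y 0<1)

  ⁻¹-cong : ∀ {x y} → x ≈ y → ¬ (x ≈ 0#) → x ⁻¹ ≈ y ⁻¹
  ⁻¹-cong {x} {y} x≈y x≉0 = begin-equality
    x ⁻¹                ≈⟨ *-identityʳ (x ⁻¹) ⟨
    x ⁻¹ * 1#           ≈⟨ *-congˡ (⁻¹-inverse y y≉0) ⟨
    x ⁻¹ * (y * y ⁻¹)   ≈⟨ *-assoc (x ⁻¹) y (y ⁻¹) ⟨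
    (x ⁻¹ * y) * y ⁻¹   ≈⟨ *-congʳ (trans (*-comm (x ⁻¹) y) (*-congʳ (sym x≈y))) ⟩
    (x * x ⁻¹) * y ⁻¹   ≈⟨ *-congʳ (⁻¹-inverse x x≉0) ⟩
    1# * y ⁻¹           ≈⟨ *-identityˡ (y ⁻¹) ⟩
    y ⁻¹                ∎
    where
    y≉0 : ¬ (y ≈ 0#)
    y≉0 y≈0 = x≉0 (trans x≈y y≈0)

  -- x⁻¹ ≠ 0 because x · x⁻¹ = 1, and x⁻¹ ≤ 0 would give 1 = x · x⁻¹ ≤ 0.
  ⁻¹-pos : ∀ {x} → 0# <ᶠ x → 0# <ᶠ (x ⁻¹)
  ⁻¹-pos {x} (0≤x , 0≉x) = 0≤x⁻¹ , λ 0≈x⁻¹ → 0≉1 (begin-equality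
    0#          ≈⟨ zeroʳ x ⟨
    x * 0#      ≈⟨ *-congˡ 0≈x⁻¹ ⟩
    x * x ⁻¹    ≈⟨ ⁻¹-inverse x x≉0 ⟩
    1#          ∎)
    where
    x≉0 : ¬ (x ≈ 0#)
    x≉0 x≈0 = 0≉x (sym x≈0)
    0≤x⁻¹ : 0# ≤ x ⁻¹
    0≤x⁻¹ with ≤.total 0# (x ⁻¹)
    ... | inj₁ 0≤x⁻¹ = 0≤x⁻¹
    ... | inj₂ x⁻¹≤0 = ⊥-elim (0≉1 (≤.antisym 0≤1 (begin
      1#        ≈⟨ ⁻¹-inverse x x≉0 ⟨
      x * x ⁻¹  ≤⟨ *-monoʳ-≤ 0≤x x⁻¹≤0 ⟩
      x * 0#    ≈⟨ zeroʳ x ⟩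
      0#        ∎)))

  *-pos : ∀ {x y} → 0# <ᶠ x → 0# <ᶠ y → 0# <ᶠ (x * y)
  *-pos {x} {y} (0≤x , 0≉x) (0≤y , 0≉y) = *-nonneg 0≤x 0≤y , λ 0≈xy → 0≉x (sym (begin-equality
    x                  ≈⟨ *-identityʳ x ⟨
    x * 1#             ≈⟨ *-congˡ (⁻¹-inverse y (λ y≈0 → 0≉y (sym y≈0))) ⟨
    x * (y * y ⁻¹)     ≈⟨ *-assoc x y (y ⁻¹) ⟨
    (x * y) * y ⁻¹     ≈⟨ *-congʳ 0≈xy ⟨
    0# * y ⁻¹          ≈⟨ zeroˡ (y ⁻¹) ⟩
    0#                 ∎))

  half+half : ∀ ε → ε * 2# ⁻¹ + ε * 2# ⁻¹ ≈ ε
  half+half ε = begin-equality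
    ε * 2# ⁻¹ + ε * 2# ⁻¹          ≈⟨ distribˡ ε (2# ⁻¹) (2# ⁻¹) ⟨
    ε * (2# ⁻¹ + 2# ⁻¹)            ≈⟨ *-congˡ (+-cong (*-identityˡ (2# ⁻¹)) (*-identityˡ (2# ⁻¹))) ⟨
    ε * (1# * 2# ⁻¹ + 1# * 2# ⁻¹)  ≈⟨ *-congˡ (distribʳ (2# ⁻¹) 1# 1#) ⟨
    ε * (2# * 2# ⁻¹)               ≈⟨ *-congˡ (⁻¹-inverse 2# (λ 2≈0 → proj₂ 0<2 (sym 2≈0))) ⟩
    ε * 1#                         ≈⟨ *-identityʳ ε ⟩
    ε                              ∎

  half-in-unit : ∀ {ε} → 0# <ᶠ ε → ε <ᶠ 1# → (0# <ᶠ (ε * 2# ⁻¹)) × ((ε * 2# ⁻¹) <ᶠ 1#)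
  half-in-unit {ε} 0<ε ε<1 = 0<h , <ᶠ-trans (<ᶠ-respʳ-≈ (x<x+y 0<h) (half+half ε)) ε<1
    where
    0<h : 0# <ᶠ (ε * 2# ⁻¹)
    0<h = *-pos 0<ε (⁻¹-pos 0<2)

  fromℕ-+ : ∀ m n → fromℕ (m Nat.+ n) ≈ fromℕ m + fromℕ n
  fromℕ-+ zero    n = sym (+-identityˡ (fromℕ n))
  fromℕ-+ (suc m) n = trans (+-congˡ (fromℕ-+ m n)) (sym (+-assoc 1# (fromℕ m) (fromℕ n)))

  fromℕ-nonneg : ∀ n → 0# ≤ fromℕ n
  fromℕ-nonneg zero    = ≤.refl
  fromℕ-nonneg (suc n) = begin
    0#             ≈⟨ +-identityˡ 0# ⟨
    0# + 0#        ≤⟨ +-mono₂-≤ 0≤1 (fromℕ-nonneg n) ⟩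
    1# + fromℕ n   ∎

  fromℕ-mono : ∀ {m n} → m Nat.≤ n → fromℕ m ≤ fromℕ n
  fromℕ-mono {m} {n} m≤n = begin
    fromℕ m                      ≈⟨ +-identityʳ (fromℕ m) ⟨
    fromℕ m + 0#                 ≤⟨ +-monoʳ-≤ (fromℕ m) (fromℕ-nonneg (n ∸ m)) ⟩
    fromℕ m + fromℕ (n ∸ m)      ≈⟨ fromℕ-+ m (n ∸ m) ⟨
    fromℕ (m Nat.+ (n ∸ m))        ≡⟨ cong fromℕ (ℕₚ.m+[n∸m]≡n m≤n) ⟩
    fromℕ n                      ∎

  fromℕ-+-≤ : ∀ a b c d → a Nat.+ b Nat.≤ c Nat.+ d → fromℕ a + fromℕ b ≤ fromℕ c + fromℕ d
  fromℕ-+-≤ a b c d a+b≤c+d = begin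
    fromℕ a + fromℕ b    ≈⟨ fromℕ-+ a b ⟨
    fromℕ (a Nat.+ b)    ≤⟨ fromℕ-mono a+b≤c+d ⟩
    fromℕ (c Nat.+ d)    ≈⟨ fromℕ-+ c d ⟩
    fromℕ c + fromℕ d    ∎

  cancel-middle : ∀ x {y} z → ¬ (y ≈ 0#) → (z * y ⁻¹) * (y * x ⁻¹) ≈ z * x ⁻¹
  cancel-middle x {y} z y≉0 = begin-equality
    (z * y ⁻¹) * (y * x ⁻¹)   ≈⟨ *-assoc z (y ⁻¹) (y * x ⁻¹) ⟩
    z * (y ⁻¹ * (y * x ⁻¹))   ≈⟨ *-congˡ (*-assoc (y ⁻¹) y (x ⁻¹)) ⟨
    z * ((y ⁻¹ * y) * x ⁻¹)   ≈⟨ *-congˡ (*-congʳ (trans (*-comm (y ⁻¹) y) (⁻¹-inverse y y≉0))) ⟩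
    z * (1# * x ⁻¹)           ≈⟨ *-congˡ (*-identityˡ (x ⁻¹)) ⟩
    z * x ⁻¹                  ∎

  union-bound : ∀ {ε h N a b c} → ε ≈ h + h →
    (1# - h) * N ≤ a → (1# - h) * N ≤ b → a + b ≤ c + N → (1# - ε) * N ≤ c
  union-bound {ε} {h} {N} {a} {b} {c} ε≈2h hN≤a hN≤b a+b≤c+N = +-cancelʳ-≤ N (begin
    (1# - ε) * N + N               ≈⟨ +-congˡ (*-identityˡ N) ⟨
    (1# - ε) * N + 1# * N          ≈⟨ distribʳ N (1# - ε) 1# ⟨
    ((1# - ε) + 1#) * N            ≈⟨ *-congʳ two-halves ⟩
    ((1# - h) + (1# - h)) * N      ≈⟨ distribʳ N (1# - h) (1# - h) ⟩
    (1# - h) * N + (1# - h) * N    ≤⟨ +-mono₂-≤ hN≤a hN≤b ⟩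
    a + b                          ≤⟨ a+b≤c+N ⟩
    c + N                          ∎)
    where
    two-halves : (1# - ε) + 1# ≈ (1# - h) + (1# - h)
    two-halves = begin-equality
      (1# - ε) + 1#                  ≈⟨ +-congʳ (+-congˡ (trans (-‿cong ε≈2h) (sym (-‿+-comm h h)))) ⟩
      (1# + (- h + - h)) + 1#        ≈⟨ xy∙z≈xz∙y 1# (- h + - h) 1# ⟩
      (1# + 1#) + (- h + - h)        ≈⟨ interchange 1# 1# (- h) (- h) ⟩
      (1# - h) + (1# - h)            ∎

module Counting where
  open ℕₚ.≤-Reasoning

  count-mono : {P : Pred A p} {Q : Pred A q} (P? : Decidable P) (Q? : Decidable Q) →
    (∀ {x} → P x → Q x) → ∀ xs → length (filter P? xs) Nat.≤ length (filter Q? xs)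
  count-mono P? Q? P⇒Q xs = length-mono-≤ (Sublist.filter⁺ P? Q? (λ { refl → P⇒Q }) (⊆-refl {x = xs}))

  private
    add-one-each : ∀ {a b c l} → a Nat.+ b Nat.≤ c Nat.+ l → a Nat.+ suc b Nat.≤ c Nat.+ suc l
    add-one-each {a} {b} {c} {l} a+b≤c+l =
      subst₂ Nat._≤_ (≡.sym (ℕₚ.+-suc a b)) (≡.sym (ℕₚ.+-suc c l)) (s≤s a+b≤c+l)

  count-∩ : {P : Pred A p} {Q : Pred A q} (P? : Decidable P) (Q? : Decidable Q) → ∀ xs →
    length (filter P? xs) Nat.+ length (filter Q? xs) Nat.≤ length (filter (P? ∩? Q?) xs) Nat.+ length xs
  count-∩ P? Q? [] = z≤n
  count-∩ P? Q? (x ∷ xs) with P? x | Q? x | count-∩ P? Q? xs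
  ... | yes _ | yes _ | ih = s≤s (add-one-each ih)
  ... | yes _ | no _  | ih = ℕₚ.≤-trans (s≤s ih) (ℕₚ.≤-reflexive (≡.sym (ℕₚ.+-suc _ _)))
  ... | no _  | yes _ | ih = add-one-each ih
  ... | no _  | no _  | ih = ℕₚ.≤-trans ih (ℕₚ.+-monoʳ-≤ _ (ℕₚ.n≤1+n _))

  count-map : {P : Pred B p} (P? : Decidable P) (f : A → B) → ∀ xs →
    length (filter P? (map f xs)) ≡ length (filter (P? ∘ f) xs)
  count-map P? f [] = refl
  count-map P? f (x ∷ xs) with P? (f x)
  ... | yes _ = cong suc (count-map P? f xs)
  ... | no _  = count-map P? f xs

  pigeonhole : (s : A → B) {xs : List A} {ys : List B} → Unique xs →
    (∀ {x x'} → x ∈ xs → x' ∈ xs → s x ≡ s x' → x ≡ x') →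
    (∀ {x} → x ∈ xs → s x ∈ ys) → length xs Nat.≤ length ys
  pigeonhole s {[]} _ _ _ = z≤n
  pigeonhole s {x ∷ xs} {ys} (x∉xs ∷ xs-unique) s-inj s-into
    with us , vs , refl ← ∈-∃++ (s-into (here refl)) = begin
    suc (length xs)                       ≤⟨ s≤s (pigeonhole s xs-unique (λ m m' → s-inj (there m) (there m')) into-rest) ⟩
    suc (length (us ++ vs))               ≡⟨ cong suc (length-++ us) ⟩
    suc (length us Nat.+ length vs)       ≡⟨ ℕₚ.+-suc (length us) (length vs) ⟨
    length us Nat.+ length (s x ∷ vs)     ≡⟨ length-++ us ⟨
    length (us ++ s x ∷ vs)               ∎
    where
    into-rest : ∀ {x'} → x' ∈ xs → s x' ∈ us ++ vs
    into-rest {x'} x'∈xs with ∈-++⁻ us (s-into (there x'∈xs))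
    ... | inj₁ ∈us         = ∈-++⁺ˡ ∈us
    ... | inj₂ (here sx'≡sx) = ⊥-elim (All.lookup x∉xs x'∈xs
                                 (≡.sym (s-inj (there x'∈xs) (here refl) sx'≡sx)))
    ... | inj₂ (there ∈vs) = ∈-++⁺ʳ us ∈vs

-- The list `pairs F n` of Defs: all (i , j) with i < j, i.e. each unordered
-- pair of distinct points of Fin n exactly once.  (It mentions F only because
-- Defs declares it inside a module parametrised by the field.)
module Pairs {c ℓ₁ ℓ₂} (F : OrderedField c ℓ₁ ℓ₂) where
  open Counting
  open ≡.≡-Reasoning

  private
    ordered? : ∀ {n} → Decidable (λ (p : Fin n × Fin n) → proj₁ p Fin.< proj₂ p)
    ordered? p = proj₁ p <? proj₂ p

  rows≡cartesianProduct : (xs : List A) (ys : List B) →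
    concatMap (λ i → map (λ j → (i , j)) ys) xs ≡ cartesianProduct xs ys
  rows≡cartesianProduct []       ys = refl
  rows≡cartesianProduct (x ∷ xs) ys = cong (map (x ,_) ys ++_) (rows≡cartesianProduct xs ys)

  pairs≡ : ∀ n → pairs F n ≡ filter ordered? (cartesianProduct (allFin n) (allFin n))
  pairs≡ n = cong (filter ordered?) (rows≡cartesianProduct (allFin n) (allFin n))

  ∈-pairs⁺ : ∀ {n} {i j : Fin n} → i Fin.< j → (i , j) ∈ pairs F n
  ∈-pairs⁺ {n} i<j = subst (_ ∈_) (≡.sym (pairs≡ n))
    (∈-filter⁺ ordered? (∈-cartesianProduct⁺ (∈-allFin _) (∈-allFin _)) i<j)

  ∈-pairs⁻ : ∀ {n} {p : Fin n × Fin n} → p ∈ pairs F n → proj₁ p Fin.< proj₂ p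
  ∈-pairs⁻ {n} p∈ = proj₂ (∈-filter⁻ ordered? {xs = cartesianProduct (allFin n) (allFin n)}
                                      (subst (_ ∈_) (pairs≡ n) p∈))

  pairs-unique : ∀ n → Unique (pairs F n)
  pairs-unique n = subst Unique (≡.sym (pairs≡ n))
    (Unique.filter⁺ ordered? (Unique.cartesianProduct⁺ (Unique.allFin⁺ n) (Unique.allFin⁺ n)))

  count-above : ∀ {n} (i : Fin n) → length (filter (i <?_) (allFin n)) ≡ n ∸ suc (toℕ i)
  count-above {suc n} Fin.zero = begin
    length (filter (Fin.zero {n} <?_) (tabulate {n = n} Fin.suc))
      ≡⟨ cong length (filter-all (Fin.zero {n} <?_) {tabulate {n = n} Fin.suc}
                                 (tabulate⁺ (λ _ → s≤s z≤n))) ⟩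
    length (tabulate {n = n} Fin.suc)
      ≡⟨ length-tabulate Fin.suc ⟩
    n ∎
  count-above {suc n} (Fin.suc i) = begin
    length (filter (Fin.suc i <?_) (tabulate {n = n} Fin.suc))
      ≡⟨ cong (length ∘ filter (Fin.suc i <?_)) (map-tabulate {n = n} (λ j → j) Fin.suc) ⟨
    length (filter (Fin.suc i <?_) (map Fin.suc (allFin n)))
      ≡⟨ count-map (Fin.suc i <?_) Fin.suc (allFin n) ⟩
    length (filter (λ j → Fin.suc i <? Fin.suc j) (allFin n))
      ≡⟨ cong length (filter-≐ _ (i <?_) ((λ { (s≤s i<j) → i<j }) , s≤s) (allFin n)) ⟩
    length (filter (i <?_) (allFin n))
      ≡⟨ count-above i ⟩
    n ∸ suc (toℕ i) ∎

  count-rows : ∀ {n} (xs : List (Fin n)) →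
    length (filter ordered? (cartesianProduct xs (allFin n))) ≡ sum (map (λ i → n ∸ suc (toℕ i)) xs)
  count-rows []       = refl
  count-rows {n} (x ∷ xs) = begin
    length (filter ordered? (row ++ rest))
      ≡⟨ cong length (filter-++ ordered? row rest) ⟩
    length (filter ordered? row ++ filter ordered? rest)
      ≡⟨ length-++ (filter ordered? row) ⟩
    length (filter ordered? row) Nat.+ length (filter ordered? rest)
      ≡⟨ cong₂ Nat._+_ (≡.trans (count-map ordered? (x ,_) (allFin n)) (count-above x)) (count-rows xs) ⟩
    (n ∸ suc (toℕ x)) Nat.+ sum (map (λ i → n ∸ suc (toℕ i)) xs) ∎
    where
    row  = map (x ,_) (allFin n)
    rest = cartesianProduct xs (allFin n)

  sum-above : ∀ n → sum (tabulate {n = n} (λ i → n ∸ suc (toℕ i))) ≡ n C 2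
  sum-above zero    = refl
  sum-above (suc n) = begin
    n Nat.+ sum (tabulate {n = n} (λ i → n ∸ suc (toℕ i)))  ≡⟨ cong (n Nat.+_) (sum-above n) ⟩
    n Nat.+ n C 2                                         ≡⟨ cong (Nat._+ n C 2) (nC1≡n n) ⟨
    n C 1 Nat.+ n C 2                                     ≡⟨ nCk+nC[k+1]≡[n+1]C[k+1] n 1 ⟩
    suc n C 2                                             ∎

  length-pairs : ∀ n → length (pairs F n) ≡ n C 2
  length-pairs n = begin
    length (pairs F n)
      ≡⟨ cong length (pairs≡ n) ⟩
    length (filter ordered? (cartesianProduct (allFin n) (allFin n)))
      ≡⟨ count-rows (allFin n) ⟩
    sum (map (λ i → n ∸ suc (toℕ i)) (allFin n))
      ≡⟨ cong sum (map-tabulate {n = n} (λ i → i) (λ i → n ∸ suc (toℕ i))) ⟩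
    sum (tabulate {n = n} (λ i → n ∸ suc (toℕ i)))
      ≡⟨ sum-above n ⟩
    n C 2 ∎

  sort : ∀ {n} → Fin n → Fin n → Fin n × Fin n
  sort a b with a <? b
  ... | yes _ = a , b
  ... | no  _ = b , a

  sort-cases : ∀ {n} (a b : Fin n) → sort a b ≡ (a , b) ⊎ sort a b ≡ (b , a)
  sort-cases a b with a <? b
  ... | yes _ = inj₁ refl
  ... | no  _ = inj₂ refl

  sort-ordered : ∀ {n} {a b : Fin n} → a ≢ b → proj₁ (sort a b) Fin.< proj₂ (sort a b)
  sort-ordered {a = a} {b} a≢b with a <? b
  ... | yes a<b = a<b
  ... | no  a≮b = ≤∧≢⇒< (ℕₚ.≮⇒≥ a≮b) (a≢b ∘ ≡.sym)

  sort-determines : ∀ {n} {a b c d : Fin n} → sort a b ≡ sort c d → (a ≡ c × b ≡ d) ⊎ (a ≡ d × b ≡ c)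
  sort-determines {a = a} {b} {c} {d} e with sort-cases a b | sort-cases c d
  ... | inj₁ ab | inj₁ cd = inj₁ (components (≡.trans (≡.sym ab) (≡.trans e cd)))
  ... | inj₁ ab | inj₂ dc = inj₂ (components (≡.trans (≡.sym ab) (≡.trans e dc)))
  ... | inj₂ ba | inj₁ cd = inj₂ (Product.swap (components (≡.trans (≡.sym ba) (≡.trans e cd))))
  ... | inj₂ ba | inj₂ dc = inj₁ (Product.swap (components (≡.trans (≡.sym ba) (≡.trans e dc))))

  -- A surjection f : Fin n → Fin m hits every unordered pair of Fin m, so a
  -- symmetric property of pairs holds, through f, for at least as many pairs
  -- of Fin n as it does for pairs of Fin m.
  count-pairs-surjection : ∀ {n m} (f : Fin n → Fin m) → Surjective _≡_ _≡_ f →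
    {P : Pred (Fin m × Fin m) p} (P? : Decidable P) → (∀ {y y'} → P (y , y') → P (y' , y)) →
    length (filter P? (pairs F m)) Nat.≤ length (filter (P? ∘ Product.map f f) (pairs F n))
  count-pairs-surjection {n = n} {m} f f-surj {P = P} P? P-sym =
    pigeonhole lift (Unique.filter⁺ P? (pairs-unique m)) lift-injective lift-good
    where
    open Section f-surj

    lift : Fin m × Fin m → Fin n × Fin n
    lift (y , y') = sort (section y) (section y')

    good : List (Fin m × Fin m)
    good = filter P? (pairs F m)

    good-ordered : ∀ {p} → p ∈ good → proj₁ p Fin.< proj₂ p
    good-ordered p∈ = ∈-pairs⁻ (proj₁ (∈-filter⁻ P? {xs = pairs F m} p∈))

    lift-injective : ∀ {p p'} → p ∈ good → p' ∈ good → lift p ≡ lift p' → p ≡ p'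
    lift-injective {y₁ , y₂} {y₁' , y₂'} p∈ p'∈ e with sort-determines e
    ... | inj₁ (e₁ , e₂) = cong₂ _,_ (section-injective e₁) (section-injective e₂)
    ... | inj₂ (e₁ , e₂) = ⊥-elim (<-asym (good-ordered p∈)
           (subst₂ Fin._<_ (≡.sym (section-injective e₂)) (≡.sym (section-injective e₁)) (good-ordered p'∈)))

    P-through-section : ∀ {y y'} → P (y , y') → P (f (section y) , f (section y'))
    P-through-section = subst₂ (λ u v → P (u , v)) (≡.sym (f∘section _)) (≡.sym (f∘section _))

    lift-good : ∀ {p} → p ∈ good → lift p ∈ filter (P? ∘ Product.map f f) (pairs F n)
    lift-good {y , y'} p∈ = ∈-filter⁺ (P? ∘ Product.map f f)
      (∈-pairs⁺ (sort-ordered (λ e → <⇒≢ (good-ordered p∈) (section-injective e))))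
      (P-lift (sort-cases (section y) (section y')))
      where
      Py : P (y , y')
      Py = proj₂ (∈-filter⁻ P? {xs = pairs F m} p∈)
      P-lift : lift (y , y') ≡ (section y , section y') ⊎ lift (y , y') ≡ (section y' , section y) →
               P (Product.map f f (lift (y , y')))
      P-lift (inj₁ e) = subst (P ∘ Product.map f f) (≡.sym e) (P-through-section Py)
      P-lift (inj₂ e) = subst (P ∘ Product.map f f) (≡.sym e) (P-through-section (P-sym Py))

module DistortionProperties {c ℓ₁ ℓ₂} (F : OrderedField c ℓ₁ ℓ₂) where
  open OrderedField F renaming (refl to ≈-refl; sym to ≈-sym; trans to ≈-trans)
  open OrderedFieldProperties F
  open FiniteMetric renaming (sym to d-sym)

  module _ {n} (A : FiniteMetric F n) where

    d-pos : ∀ {a a'} → a ≢ a' → 0# <ᶠ d A a a'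
    d-pos {a} {a'} a≢a' = nonneg A a a' , λ 0≈d → a≢a' (zero⇔eq₁ A a a' (≈-sym 0≈d))

  module _ {n m} (A : FiniteMetric F n) (B : FiniteMetric F m) (h : Fin n → Fin m) where

    distortion-diag : ∀ a → distortion F A B h a a ≈ 0#
    distortion-diag a = ≈-trans (*-congʳ (zero⇔eq₂ B (h a))) (zeroˡ _)

    distortion-nonneg : ∀ a a' → 0# ≤ distortion F A B h a a'
    distortion-nonneg a a' with a ≟ a'
    ... | yes refl  = ≤.reflexive (≈-sym (distortion-diag a))
    ... | no a≢a'   = *-nonneg (nonneg B (h a) (h a')) (proj₁ (⁻¹-pos (d-pos A a≢a')))

    distortion-sym : ∀ a a' → distortion F A B h a' a ≈ distortion F A B h a a'
    distortion-sym a a' with a ≟ a'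
    ... | yes refl  = ≈-refl
    ... | no a≢a'   = *-cong (d-sym B (h a') (h a))
                        (⁻¹-cong (d-sym A a' a) (λ d≈0 → proj₂ (d-pos A (a≢a' ∘ ≡.sym)) (≈-sym d≈0)))

    noncontractive⇒injective : NonContractive F A B h → ∀ {a a'} → h a ≡ h a' → a ≡ a'
    noncontractive⇒injective h-nc {a} {a'} ha≡ha' = zero⇔eq₁ A a a' (≤.antisym
      (≤.trans (h-nc a a') (≤.reflexive (subst (λ y → d B (h a) y ≈ 0#) ha≡ha' (zero⇔eq₂ B (h a)))))
      (nonneg A a a'))

  distortion-∘ : ∀ {n m k} (X : FiniteMetric F n) (Y : FiniteMetric F m) (Z : FiniteMetric F k)
    (f : Fin n → Fin m) (g : Fin m → Fin k) → (∀ {a a'} → f a ≡ f a' → a ≡ a') → ∀ a a' →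
    distortion F X Z (g ∘ f) a a' ≈ distortion F Y Z g (f a) (f a') * distortion F X Y f a a'
  distortion-∘ X Y Z f g f-inj a a' with a ≟ a'
  ... | yes refl = ≈-trans (distortion-diag X Z (g ∘ f) a)
                     (≈-sym (≈-trans (*-congʳ (distortion-diag Y Z g (f a))) (zeroˡ _)))
  ... | no a≢a'  = ≈-sym (cancel-middle (d X a a') (d Z (g (f a)) (g (f a')))
                     (λ d≈0 → proj₂ (d-pos Y (a≢a' ∘ f-inj)) (≈-sym d≈0)))

module Composition {c ℓ₁ ℓ₂} (F : OrderedField c ℓ₁ ℓ₂) {n m k}
  (X : FiniteMetric F n) (Y : FiniteMetric F m) (Z : FiniteMetric F k)
  (f : Fin n → Fin m) (g : Fin m → Fin k)
  (f-nc : NonContractive F X Y f) (f-surj : Surjective _≡_ _≡_ f) where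

  open OrderedField F
  open OrderedFieldProperties F
  open DistortionProperties F
  open Counting
  open Pairs F
  open ℕₚ.≤-Reasoning

  f-injective : ∀ {a a'} → f a ≡ f a' → a ≡ a'
  f-injective = noncontractive⇒injective X Y f f-nc

  n≡m : n ≡ m
  n≡m = cantor-schröder-bernstein f-injective (Section.section-injective f-surj)

  count-composed : ∀ s t → 0# ≤ t →
    countGood F X Y f s Nat.+ countGood F Y Z g t Nat.≤ countGood F X Z (g ∘ f) (s * t) Nat.+ n C 2
  count-composed s t 0≤t = begin
    length (filter f-good? (pairs F n)) Nat.+ length (filter g-good? (pairs F m))
      ≤⟨ ℕₚ.+-monoʳ-≤ _ (count-pairs-surjection f f-surj g-good? g-good-sym) ⟩
    length (filter f-good? (pairs F n)) Nat.+ length (filter image-good? (pairs F n))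
      ≤⟨ count-∩ f-good? image-good? (pairs F n) ⟩
    length (filter (f-good? ∩? image-good?) (pairs F n)) Nat.+ length (pairs F n)
      ≤⟨ ℕₚ.+-monoˡ-≤ _ (count-mono (f-good? ∩? image-good?) gf-good? composed-good (pairs F n)) ⟩
    length (filter gf-good? (pairs F n)) Nat.+ length (pairs F n)
      ≡⟨ cong (length (filter gf-good? (pairs F n)) Nat.+_) (length-pairs n) ⟩
    countGood F X Z (g ∘ f) (s * t) Nat.+ n C 2
      ∎
    where
    f-good? : Decidable (λ (p : Fin n × Fin n) → distortion F X Y f (proj₁ p) (proj₂ p) ≤ s)
    f-good? p = distortion F X Y f (proj₁ p) (proj₂ p) ≤? s

    g-good? : Decidable (λ (p : Fin m × Fin m) → distortion F Y Z g (proj₁ p) (proj₂ p) ≤ t)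
    g-good? p = distortion F Y Z g (proj₁ p) (proj₂ p) ≤? t

    image-good? : Decidable (λ (p : Fin n × Fin n) → distortion F Y Z g (f (proj₁ p)) (f (proj₂ p)) ≤ t)
    image-good? = g-good? ∘ Product.map f f

    gf-good? : Decidable (λ (p : Fin n × Fin n) → distortion F X Z (g ∘ f) (proj₁ p) (proj₂ p) ≤ s * t)
    gf-good? p = distortion F X Z (g ∘ f) (proj₁ p) (proj₂ p) ≤? (s * t)

    g-good-sym : ∀ {y y'} → distortion F Y Z g y y' ≤ t → distortion F Y Z g y' y ≤ t
    g-good-sym {y} {y'} = ≤.trans (≤.reflexive (distortion-sym Y Z g y y'))

    composed-good : ∀ {p} → distortion F X Y f (proj₁ p) (proj₂ p) ≤ s ×
                            distortion F Y Z g (f (proj₁ p)) (f (proj₂ p)) ≤ t →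
                            distortion F X Z (g ∘ f) (proj₁ p) (proj₂ p) ≤ s * t
    composed-good {a , a'} (f≤s , g≤t) = ≤.trans (≤.reflexive (distortion-∘ X Y Z f g f-injective a a'))
      (≤.trans (*-mono-≤ (distortion-nonneg X Y f a a') 0≤t g≤t f≤s) (≤.reflexive (*-comm t s)))

mainTheorem7 : ∀ {c ℓ₁ ℓ₂} (F : OrderedField c ℓ₁ ℓ₂) →
    let open OrderedField F in
    {n m k : ℕ} (X : FiniteMetric F n) (Y : FiniteMetric F m) (Z : FiniteMetric F k) →
    (f : Fin n → Fin m) (g : Fin m → Fin k) →
    (α β : Carrier → Carrier) →
    NonContractive F X Y f → Surjective _≡_ _≡_ f → HasScalingDistortion F X Y f α →
    NonContractive F Y Z g → Surjective _≡_ _≡_ g → HasScalingDistortion F Y Z g β →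
    HasScalingDistortion F X Z (g ∘ f) (λ ε → α (ε * 2# ⁻¹) * β (ε * 2# ⁻¹))
mainTheorem7 F {n} {m} X Y Z f g α β f-nc f-surj f-scaling _ _ g-scaling ε 0<ε ε<1 =
  *-pos (proj₁ f-bound) (proj₁ g-bound) ,
  union-bound (≈-sym (half+half ε)) (proj₂ f-bound) g-bound-on-X counts
  where
  open OrderedField F renaming (sym to ≈-sym)
  open OrderedFieldProperties F
  open Composition F X Y Z f g f-nc f-surj

  h : Carrier
  h = ε * 2# ⁻¹

  h-in-unit : (0# <ᶠ h) × (h <ᶠ 1#)
  h-in-unit = half-in-unit 0<ε ε<1

  f-bound : (0# <ᶠ α h) × ((1# - h) * fromℕ (n C 2) ≤ fromℕ (countGood F X Y f (α h)))
  f-bound = f-scaling h (proj₁ h-in-unit) (proj₂ h-in-unit)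

  g-bound : (0# <ᶠ β h) × ((1# - h) * fromℕ (m C 2) ≤ fromℕ (countGood F Y Z g (β h)))
  g-bound = g-scaling h (proj₁ h-in-unit) (proj₂ h-in-unit)

  g-bound-on-X : (1# - h) * fromℕ (n C 2) ≤ fromℕ (countGood F Y Z g (β h))
  g-bound-on-X = subst (λ N → (1# - h) * fromℕ (N C 2) ≤ fromℕ (countGood F Y Z g (β h)))
                   (≡.sym n≡m) (proj₂ g-bound)

  counts : fromℕ (countGood F X Y f (α h)) + fromℕ (countGood F Y Z g (β h)) ≤
           fromℕ (countGood F X Z (g ∘ f) (α h * β h)) + fromℕ (n C 2)
  counts = fromℕ-+-≤ (countGood F X Y f (α h)) (countGood F Y Z g (β h)) _ (n C 2)
    (count-composed (α h) (β h) (proj₁ (proj₁ g-bound)))
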